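{- Let $\Gamma$ be a semicomplete multipartite commutative weakly distance-regular digraph with $\{q\mid(1,q-1)\in\tilde\partial(\Gamma)\}=\{2,3\}$. Then $\Gamma$ is isomorphic to one of: (a) an $l$-coclique extension of a semicomplete weakly distance-regular digraph with girth $2$ or $3$, where $l\geq2$; (b) a doubly regular $(k,m)$-team semicomplete multipartite digraph of Type II, where $k,m\geq2$.
   Context: A digraph $\Gamma$ has a finite vertex set $V\Gamma$ and arcs $A\Gamma$ that are ordered pairs of distinct vertices. $\partial(x,y)$ is the length of a shortest directed path from $x$ to $y$; $\Gamma$ is strongly connected if all are finite; the girth is the length of a shortest directed circuit (girth 2: some pair is joined in both directions). $\tilde\partial(x,y)=(\partial(x,y),\partial(y,x))$, $\tilde\partial(\Gamma)$ the set of these pairs, $\Gamma_{\tilde i}=\{(x,y):\tilde\partial(x,y)=\tilde i\}$. A strongly connected $\Gamma$ is weakly distance-regular if $A\Gamma$ is not symmetric and for all $\tilde i,\tilde j,\tilde h\in\tilde\partial(\Gamma)$ the number $|\{z:(x,z)\in\Gamma_{\tilde i},(z,y)\in\Gamma_{\tilde j}\}|$ is the same for all $(x,y)\in\Gamma_{\tilde h}$; commutative if this number is symmetric in $\tilde i,\tilde j$. The underlying graph joins $x,y$ iff $(x,y)$ or $(y,x)$ is an arc; $\Gamma$ is semicomplete if it is complete, semicomplete multipartite if it is a complete multipartite graph with at least 2 parts, all of size at least 2. An $l$-coclique extension of $\Sigma$ is the lexicographic product $\Sigma\circ\overline K_l$: vertex set $V\Sigma\times\{1,\dots,l\}$, with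 $((u_1,u_2),(v_1,v_2))$ an arc iff $(u_1,v_1)\in A\Sigma$. A $(k,m)$-team semicomplete multipartite digraph is a digraph whose underlying graph is the complete multipartite graph with $k$ parts $V_1,\dots,V_k$ each of size $m$ ($k,m\ge2$). Let $E\Gamma=\{(x,y):(x,y),(y,x)\in A\Gamma\}$, $\vec\Gamma=(V\Gamma,A\Gamma\setminus E\Gamma)$, $A_0$, $A_1$ the adjacency matrices of $(V\Gamma,E\Gamma)$ and $\vec\Gamma$. A regular such $\Gamma$ is doubly regular if there are integers $t,\alpha_s,\beta_s,\gamma_s,\eta_s$ ($s=0,1,2$) with $A_iA_j=t\delta_{0,i+j}I+\alpha_{i+j}A_1+\beta_{i+j}A_1^{\top}+\gamma_{i+j}A_0+\eta_{i+j}(J-I-A_1-A_1^{\top}-A_0)$ for $i,j\in\{0,1\}$. For $x\in V_i$, $j\neq i$: $A_j^+(x)=\{y\in V_j:(x,y)\in A\vec\Gamma\}$, $E_j(x)=\{y\in V_j:(x,y)\in E\Gamma\}$. It is of Type II if $\beta_1+\beta_2-\alpha_1-\alpha_2=0$ and for each pair $i\neq j$, $|E_j(x)|$ is a constant $e_{ij}$ and $|A_j^+(x)|$ a constant $c_{ij}$ over $x\in V_i$, with $c_{ij}=c_{ji}=\frac{m-e_{ij}}{2}$. -}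

module Defs where

open import Data.Nat using (ℕ; zero; suc; _+_; _*_; _∸_; _≤_; _<_)
open import Data.Integer as ℤ using (ℤ; +_)
open import Data.Bool using (Bool; true; false; _∧_; _∨_; not; if_then_else_)
open import Data.Fin using (Fin; remQuot; toℕ)
import Data.Fin as Fin
open import Data.Fin.Properties using () renaming (_≟_ to _≟ᶠ_)
open import Data.List using (List; map; allFin)
open import Data.Nat.ListAction using (sum)
open import Data.Bool.ListAction using (any)
open import Data.Maybe using (Maybe; just; nothing)
open import Data.Product using (Σ; ∃; ∃-syntax; _×_; _,_; proj₁; proj₂)
open import Data.Sum using (_⊎_)
open import Relation.Nullary using (¬_; does)
open import Relation.Binary.PropositionalEquality using (_≡_; _≢_)
open import Function.Bundles using (_↔_; Inverse)

record Digraph (n : ℕ) : Set where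
  field
    arc    : Fin n → Fin n → Bool
    irrefl : ∀ x → arc x x ≡ false
open Digraph public

_==_ : ∀ {m} → Fin m → Fin m → Bool
x == y = does (x ≟ᶠ y)

module _ {n : ℕ} where

  count : (Fin n → Bool) → ℕ
  count p = sum (map (λ z → if p z then 1 else 0) (allFin n))

  module _ (G : Digraph n) where

    walk : ℕ → Fin n → Fin n → Bool
    walk zero    x y = x == y
    walk (suc d) x y = any (λ z → arc G x z ∧ walk d z y) (allFin n)

    search : ℕ → ℕ → Fin n → Fin n → Maybe ℕ
    search d zero     x y = nothing
    search d (suc f)  x y = if walk d x y then just d else search (suc d) f x y

    -- ∂(x,y): length of a shortest directed path from x to y
    -- (nothing = ∞).  A shortest walk is a path and has length < n,
    -- so searching lengths 0..n suffices.
    ∂ : Fin n → Fin n → Maybe ℕ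
    ∂ x y = search 0 (suc n) x y

    ∂̃ : Fin n → Fin n → Maybe ℕ × Maybe ℕ
    ∂̃ x y = (∂ x y , ∂ y x)

    In∂̃ : Maybe ℕ × Maybe ℕ → Set
    In∂̃ h = ∃[ x ] ∃[ y ] (∂̃ x y ≡ h)

    StronglyConnected : Set
    StronglyConnected = ∀ x y → ∃[ d ] (∂ x y ≡ just d)

    NotSymmetric : Set
    NotSymmetric = ∃[ x ] ∃[ y ] (arc G x y ≡ true × arc G y x ≡ false)

    p : Maybe ℕ × Maybe ℕ → Maybe ℕ × Maybe ℕ → Fin n → Fin n → ℕ
    p i j x y = count (λ z → eqP (∂̃ x z) i ∧ eqP (∂̃ z y) j)
      where
      open import Data.Maybe.Properties using (≡-dec)
      open import Data.Product.Properties using ()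
        renaming (≡-dec to ×-≡-dec)
      open import Data.Nat.Properties using () renaming (_≟_ to _≟ℕ_)
      eqP : Maybe ℕ × Maybe ℕ → Maybe ℕ × Maybe ℕ → Bool
      eqP a b = does (×-≡-dec (≡-dec _≟ℕ_) (≡-dec _≟ℕ_) a b)

    WeaklyDistanceRegular : Set
    WeaklyDistanceRegular =
      StronglyConnected × NotSymmetric ×
      (∀ i j h → In∂̃ i → In∂̃ j → In∂̃ h →
        ∀ x y x′ y′ → ∂̃ x y ≡ h → ∂̃ x′ y′ ≡ h → p i j x y ≡ p i j x′ y′)

    Commutative : Set
    Commutative = ∀ i j → In∂̃ i → In∂̃ j → ∀ x y → p i j x y ≡ p j i x y

    adj : Fin n → Fin n → Bool
    adj x y = arc G x y ∨ arc G y x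

    Semicomplete : Set
    Semicomplete = ∀ x y → x ≢ y → adj x y ≡ true

    IsPartition : (k m : ℕ) → (Fin n → Fin k) → Set
    IsPartition k m part =
      (∀ x y → (adj x y ≡ true → part x ≢ part y) × (part x ≢ part y → adj x y ≡ true))
      × (∀ i → count (λ x → part x == i) ≡ m)

    SemicompleteMultipartite : Set
    SemicompleteMultipartite =
      ∃[ k ] Σ (Fin n → Fin k) λ part → 2 ≤ k ×
        (∀ x y → (adj x y ≡ true → part x ≢ part y) × (part x ≢ part y → adj x y ≡ true))
        × (∀ i → 2 ≤ count (λ x → part x == i))

    HasCircuit : ℕ → Set
    HasCircuit g = Σ (ℕ → Fin n) λ c →
      (∀ i → i < g → arc G (c i) (c (suc i)) ≡ true) × (c g ≡ c 0)
      × (∀ i j → i < g → j < g → c i ≡ c j → i ≡ j)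

    Girth : ℕ → Set
    Girth g = HasCircuit g × (∀ g′ → 1 ≤ g′ → g′ < g → ¬ HasCircuit g′)

    Regular : Set
    Regular = ∃[ r ] ∀ x → count (λ y → arc G x y) ≡ r × count (λ y → arc G y x) ≡ r

    A₀ A₁ : Fin n → Fin n → Bool
    A₀ x y = arc G x y ∧ arc G y x
    A₁ x y = arc G x y ∧ not (arc G y x)

    Amat : Fin 2 → Fin n → Fin n → Bool
    Amat Fin.zero    = A₀
    Amat (Fin.suc _) = A₁

    -- entry (x,y) of t δ I + α A₁ + β A₁ᵀ + γ A₀ + η (J - I - A₁ - A₁ᵀ - A₀)
    rhs : Bool → ℤ → ℤ → ℤ → ℤ → ℤ → Fin n → Fin n → ℤ
    rhs δ t α β γ η x y =
      if x == y then (if δ then t else + 0)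
      else (if A₁ x y then α
      else (if A₁ y x then β
      else (if A₀ x y then γ else η)))

    isZero : ℕ → Bool
    isZero zero = true
    isZero (suc _) = false

    -- A_i A_j = t δ_{0,i+j} I + α_{i+j} A₁ + β_{i+j} A₁ᵀ + γ_{i+j} A₀ + η_{i+j} (J-I-A₁-A₁ᵀ-A₀)
    DRCoeffs : ℤ → (ℕ → ℤ) → (ℕ → ℤ) → (ℕ → ℤ) → (ℕ → ℤ) → Set
    DRCoeffs t α β γ η =
      ∀ (i j : Fin 2) x y →
        let s = toℕ i + toℕ j in
        + count (λ z → Amat i x z ∧ Amat j z y)
          ≡ rhs (isZero s) t (α s) (β s) (γ s) (η s) x y

    TypeIITeam : ℕ → ℕ → Set
    TypeIITeam k m = 2 ≤ k × 2 ≤ m × Σ (Fin n → Fin k) λ part →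
      IsPartition k m part × Regular ×
      Σ ℤ λ t → Σ (ℕ → ℤ) λ α → Σ (ℕ → ℤ) λ β →
      Σ (ℕ → ℤ) λ γ → Σ (ℕ → ℤ) λ η →
        DRCoeffs t α β γ η
        × (β 1 ℤ.+ β 2 ℤ.- α 1 ℤ.- α 2 ≡ + 0)
        × Σ (Fin k → Fin k → ℕ) λ e → Σ (Fin k → Fin k → ℕ) λ c →
          (∀ i j → i ≢ j → ∀ x → part x ≡ i →
             count (λ y → (part y == j) ∧ A₀ x y) ≡ e i j
           × count (λ y → (part y == j) ∧ A₁ x y) ≡ c i j)
          × (∀ i j → i ≢ j → c i j ≡ c j i × 2 * c i j + e i j ≡ m)

-- l-coclique extension Σ ∘ K̄_l, vertex set Fin (s * l) ≅ Fin s × Fin l via remQuot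
cocliqueExt : ∀ {s} → Digraph s → (l : ℕ) → Digraph (s * l)
cocliqueExt S l = record
  { arc    = λ x y → arc S (proj₁ (remQuot l x)) (proj₁ (remQuot l y))
  ; irrefl = λ x → irrefl S (proj₁ (remQuot l x)) }

_≅_ : ∀ {n n′} → Digraph n → Digraph n′ → Set
_≅_ {n} {n′} G H = Σ (Fin n ↔ Fin n′) λ f →
  ∀ x y → arc H (Inverse.to f x) (Inverse.to f y) ≡ arc G x y

{-# OPTIONS --safe #-}
-- Since (1,1) and (1,2) are the only distance pairs with first entry 1, an arc x → y without its
-- reverse has ∂(y,x) = 2, so adjacent pairs fall into the three classes of A₀, A₁ and A₁ᵀ. Counting
-- the neighbours of x in the part of y shows that these degrees depend only on the class of (x,y),
-- and commutativity gives deg_T(x, part y) = deg_{Tᵀ}(y, part x).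
-- If any two vertices of a part have the same in- and out-neighbours, Γ is the coclique extension of
-- the quotient digraph on the parts, which inherits weak distance-regularity and has girth 2.
-- Otherwise some w meets two vertices of one part in different relations; the symmetry of the degree
-- table then forces every vertex to have as many out- as in-neighbours in each other part. A count
-- inside one part now joins any two vertices of a part by a path of length 2, so the non-adjacent pairs
-- form the single class (2,2), the products A_i A_j are constant on classes, and Γ is a doubly regular
-- team digraph of Type II.
module Submission where

open import Defs
open import Data.Nat using (ℕ; zero; suc; _+_; _*_; _≤_; _<_; z≤n; s≤s; NonZero; >-nonZero)
open import Data.Nat.Properties
  using ( +-*-semiring; +-commutativeSemigroup; +-comm; +-identityʳ; *-comm; +-cancelˡ-≡; +-cancelʳ-≡
        ; m≤m+n; +-monoʳ-≤; +-monoˡ-≤; +-cancelˡ-≤; ≤-trans; ≤-reflexive; *-cancelˡ-≡; 1+n≰n; <⇒≢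
        ; module ≤-Reasoning )
  renaming (_≟_ to _≟ℕ_)
open import Data.Nat.ListAction as List using ()
import Data.Nat.Tactic.RingSolver as ℕ-Solver
open import Data.Integer as ℤ using (ℤ)
import Data.Integer.Tactic.RingSolver as ℤ-Solver
open import Data.Bool using (Bool; true; false; _∧_; _∨_; not; if_then_else_)
open import Data.Bool.Properties
  using ( ∧-comm; ∨-comm; ∧-idem; ∧-zeroʳ; ∧-identityʳ; ∧-distribˡ-∨; ¬-not; not-injective; T-≡
        ; ∧-conicalˡ; ∧-conicalʳ; ∨-conicalˡ; ∨-conicalʳ )
  renaming (_≟_ to _≟ᵇ_)
open import Data.Bool.ListAction using (any)
open import Data.Fin using (Fin; zero; suc; toℕ; fromℕ<; combine; remQuot; punchOut)
open import Data.Fin.Properties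
  using (any?; <-cmp; injective⇒≤; punchOut-injective; combine-injective; remQuot-combine; fromℕ<-injective)
  renaming (_≟_ to _≟ᶠ_; _<?_ to _<?ᶠ_; <-trans to <ᶠ-trans; <-irrefl to <ᶠ-irrefl)
open import Data.List using (tabulate; allFin)
open import Data.List.Properties using (map-tabulate)
open import Data.List.Membership.Propositional using (lose)
open import Data.List.Membership.Propositional.Properties using (∈-allFin)
open import Data.List.Relation.Unary.Any using (satisfied)
open import Data.List.Relation.Unary.Any.Properties using (any⁺; any⁻)
open import Data.Maybe using (Maybe; just)
open import Data.Maybe.Properties using (just-injective) renaming (≡-dec to Maybe-≡-dec)
open import Data.Product using (Σ; ∃-syntax; _×_; _,_; proj₁; proj₂; swap; uncurry)
open import Data.Product.Properties using (,-injective) renaming (≡-dec to ×-≡-dec)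
open import Data.Sum using (_⊎_; inj₁; inj₂)
open import Relation.Nullary using (¬_; Dec; does; yes; no; contradiction)
open import Relation.Nullary.Decidable using (dec-true; dec-false; does-⇔; decidable-stable; _×-dec_; ¬?)
open import Relation.Binary.Definitions using (DecidableEquality; tri<; tri≈; tri>)
open import Relation.Binary.PropositionalEquality
open import Function using (_∘_; id; flip; Injective; _⇔_; _↔_; Inverse; Equivalence; mk⇔; mk↔ₛ′)
open import Function.Construct.Identity using (↔-id)
open import Algebra.Properties.Semiring.Sum +-*-semiring
  using (sum-syntax; sum-cong-≗; ∑-distrib-+; ∑-comm; *-distribˡ-sum; *-distribʳ-sum)
open import Algebra.Properties.CommutativeSemigroup +-commutativeSemigroup using (xy∙z≈xz∙y)

-- Counting over Fin n

𝟙 : Bool → ℕ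
𝟙 b = if b then 1 else 0

𝟙-∧ : ∀ b c → 𝟙 (b ∧ c) ≡ 𝟙 b * 𝟙 c
𝟙-∧ false c     = refl
𝟙-∧ true  false = refl
𝟙-∧ true  true  = refl

𝟙-split : ∀ b c → 𝟙 b ≡ 𝟙 (b ∧ c) + 𝟙 (b ∧ not c)
𝟙-split false c     = refl
𝟙-split true  false = refl
𝟙-split true  true  = refl

𝟙-inclusion-exclusion : ∀ b c → 𝟙 b + 𝟙 c ≡ 𝟙 (b ∨ c) + 𝟙 (b ∧ c)
𝟙-inclusion-exclusion false false = refl
𝟙-inclusion-exclusion false true  = refl
𝟙-inclusion-exclusion true  false = refl
𝟙-inclusion-exclusion true  true  = refl

==-refl : ∀ {n} (x : Fin n) → (x == x) ≡ true
==-refl x = dec-true (x ≟ᶠ x) refl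

bool-ext : ∀ {b c : Bool} → (b ≡ true → c ≡ true) → (c ≡ true → b ≡ true) → b ≡ c
bool-ext {false} {false} _  _    = refl
bool-ext {false} {true}  _  from = from refl
bool-ext {true}  {false} to _    = sym (to refl)
bool-ext {true}  {true}  _  _    = refl

==-false : ∀ {n} {x y : Fin n} → x ≢ y → (x == y) ≡ false
==-false {x = x} {y} x≢y = dec-false (x ≟ᶠ y) x≢y

==-sym : ∀ {n} (x y : Fin n) → (x == y) ≡ (y == x)
==-sym x y = does-⇔ (mk⇔ sym sym) (x ≟ᶠ y) (y ≟ᶠ x)

does-reflects : ∀ {P : Set} {b : Bool} (P? : Dec P) → (P → b ≡ true) → (b ≡ true → P) → does P? ≡ b
does-reflects (yes p) to from = sym (to p)
does-reflects (no ¬p) to from = sym (¬-not (¬p ∘ from))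

any-allFin⁺ : ∀ {n} (p : Fin n → Bool) {z : Fin n} → p z ≡ true → any p (allFin n) ≡ true
any-allFin⁺ p {z} pz = Equivalence.to T-≡ (any⁺ p (lose (∈-allFin z) (Equivalence.from T-≡ pz)))

any-allFin⁻ : ∀ {n} (p : Fin n → Bool) → any p (allFin n) ≡ true → ∃[ z ] p z ≡ true
any-allFin⁻ p found with z , pz ← satisfied (any⁻ p (allFin _) (Equivalence.from T-≡ found)) =
  z , Equivalence.to T-≡ pz

does⇒ : ∀ {P : Set} (P? : Dec P) → does P? ≡ true → P
does⇒ (yes p) _ = p

==⇒≡ : ∀ {n} {x y : Fin n} → (x == y) ≡ true → x ≡ y
==⇒≡ {x = x} {y} = does⇒ (x ≟ᶠ y)

∑-zero : ∀ n → ∑[ z < n ] 0 ≡ 0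
∑-zero zero    = refl
∑-zero (suc n) = ∑-zero n

∑-indicator : ∀ {n} (v : Fin n) (c : Fin n → Bool) → ∑[ w < n ] 𝟙 ((v == w) ∧ c w) ≡ 𝟙 (c v)
∑-indicator {suc n} zero    c = trans (cong (𝟙 (c zero) +_) (∑-zero n)) (+-identityʳ _)
∑-indicator {suc n} (suc v) c = ∑-indicator v (c ∘ suc)

sum-tabulate : ∀ {n} (f : Fin n → ℕ) → List.sum (tabulate f) ≡ ∑[ z < n ] f z
sum-tabulate {zero}  f = refl
sum-tabulate {suc n} f = cong (f zero +_) (sum-tabulate (f ∘ suc))

module _ {n : ℕ} where

  count≡∑ : (p : Fin n → Bool) → count p ≡ ∑[ z < n ] 𝟙 (p z)
  count≡∑ p = trans (cong List.sum (map-tabulate id (𝟙 ∘ p))) (sum-tabulate (𝟙 ∘ p))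

  count-cong : {p q : Fin n → Bool} → (∀ z → p z ≡ q z) → count p ≡ count q
  count-cong {p} {q} eq = begin
    count p              ≡⟨ count≡∑ p ⟩
    ∑[ z < n ] 𝟙 (p z)   ≡⟨ sum-cong-≗ (cong 𝟙 ∘ eq) ⟩
    ∑[ z < n ] 𝟙 (q z)   ≡⟨ count≡∑ q ⟨
    count q              ∎
    where open ≡-Reasoning

  count+count≡∑ : (p q : Fin n → Bool) → count p + count q ≡ ∑[ z < n ] (𝟙 (p z) + 𝟙 (q z))
  count+count≡∑ p q =
    trans (cong₂ _+_ (count≡∑ p) (count≡∑ q)) (sym (∑-distrib-+ (𝟙 ∘ p) (𝟙 ∘ q)))

  count-+ : {p q r : Fin n → Bool} → (∀ z → 𝟙 (p z) ≡ 𝟙 (q z) + 𝟙 (r z)) →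
            count p ≡ count q + count r
  count-+ {p} {q} {r} eq = trans (count≡∑ p) (trans (sum-cong-≗ eq) (sym (count+count≡∑ q r)))

  count-+₃ : {p q r s : Fin n → Bool} → (∀ z → 𝟙 (p z) ≡ 𝟙 (q z) + 𝟙 (r z) + 𝟙 (s z)) →
             count p ≡ count q + count r + count s
  count-+₃ {p} {q} {r} {s} eq = begin
    count p                                              ≡⟨ count≡∑ p ⟩
    ∑[ z < n ] 𝟙 (p z)                                   ≡⟨ sum-cong-≗ eq ⟩
    ∑[ z < n ] (𝟙 (q z) + 𝟙 (r z) + 𝟙 (s z))             ≡⟨ ∑-distrib-+ (λ z → 𝟙 (q z) + 𝟙 (r z)) (𝟙 ∘ s) ⟩
    ∑[ z < n ] (𝟙 (q z) + 𝟙 (r z)) + ∑[ z < n ] 𝟙 (s z)  ≡⟨ cong₂ _+_ (count+count≡∑ q r) (count≡∑ s) ⟨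
    count q + count r + count s                          ∎
    where open ≡-Reasoning

  count-split : (p q : Fin n → Bool) → count p ≡ count (λ z → p z ∧ q z) + count (λ z → p z ∧ not (q z))
  count-split p q = count-+ (λ z → 𝟙-split (p z) (q z))

  count-inclusion-exclusion : (p q : Fin n → Bool) →
    count p + count q ≡ count (λ z → p z ∨ q z) + count (λ z → p z ∧ q z)
  count-inclusion-exclusion p q = begin
    count p + count q                        ≡⟨ count+count≡∑ p q ⟩
    ∑[ z < n ] (𝟙 (p z) + 𝟙 (q z))           ≡⟨ sum-cong-≗ (λ z → 𝟙-inclusion-exclusion (p z) (q z)) ⟩
    ∑[ z < n ] (𝟙 (p z ∨ q z) + 𝟙 (p z ∧ q z)) ≡⟨ count+count≡∑ _ _ ⟨
    count (λ z → p z ∨ q z) + count (λ z → p z ∧ q z) ∎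
    where open ≡-Reasoning

  count-∧-lower-bound : (p q : Fin n → Bool) {e c : ℕ} → count p ≡ e + c → count q ≡ e + c →
                        count (λ z → p z ∨ q z) ≤ e + c + c → e ≤ count (λ z → p z ∧ q z)
  count-∧-lower-bound p q {e} {c} |p| |q| |p∨q| = +-cancelˡ-≤ (e + c + c) _ _ (begin
    e + c + c + e                                          ≡⟨ rearrange e c ⟩
    (e + c) + (e + c)                                      ≡⟨ cong₂ _+_ |p| |q| ⟨
    count p + count q                                      ≡⟨ count-inclusion-exclusion p q ⟩
    count (λ z → p z ∨ q z) + count (λ z → p z ∧ q z)      ≤⟨ +-monoˡ-≤ _ |p∨q| ⟩
    e + c + c + count (λ z → p z ∧ q z)                    ∎)
    where
    open ≤-Reasoning
    rearrange : ∀ e c → e + c + c + e ≡ (e + c) + (e + c)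
    rearrange = ℕ-Solver.solve-∀

  count-false : (p : Fin n → Bool) → (∀ z → p z ≡ false) → count p ≡ 0
  count-false p eq = trans (count≡∑ p) (trans (sum-cong-≗ (cong 𝟙 ∘ eq)) (∑-zero n))

  count-true : count {n} (λ _ → true) ≡ n
  count-true = trans (count≡∑ _) (∑-one n)
    where
    ∑-one : ∀ k → ∑[ z < k ] 1 ≡ k
    ∑-one zero    = refl
    ∑-one (suc k) = cong suc (∑-one k)

  count-witness : (p : Fin n → Bool) → 1 ≤ count p → ∃[ z ] p z ≡ true
  count-witness p 1≤count with any? (λ z → p z ≟ᵇ true)
  ... | yes found = found
  ... | no  none  = contradiction (subst (1 ≤_) (count-false p (λ z → ¬-not (λ pz → none (z , pz)))) 1≤count) λ ()

  count-with-subset : {p q : Fin n → Bool} → (∀ z → p z ≡ true → q z ≡ true) →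
                      count q ≡ count p + count (λ z → q z ∧ not (p z))
  count-with-subset {p} {q} p⊆q =
    trans (count-split q p) (cong (_+ count (λ z → q z ∧ not (p z))) (count-cong q∧p≡p))
    where
    q∧p≡p : ∀ z → q z ∧ p z ≡ p z
    q∧p≡p z with p z in pz
    ... | true  = trans (∧-identityʳ (q z)) (p⊆q z pz)
    ... | false = ∧-zeroʳ (q z)

  count-mono : {p q : Fin n → Bool} → (∀ z → p z ≡ true → q z ≡ true) → count p ≤ count q
  count-mono p⊆q = ≤-trans (m≤m+n _ _) (≤-reflexive (sym (count-with-subset p⊆q)))

  count-== : (v : Fin n) (c : Fin n → Bool) → count (λ w → (v == w) ∧ c w) ≡ 𝟙 (c v)
  count-== v c = trans (count≡∑ _) (∑-indicator v c)

  𝟙≤count : (p : Fin n → Bool) {z : Fin n} → p z ≡ true → 1 ≤ count p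
  𝟙≤count p {z} pz = subst (_≤ count p) (count-== z (λ _ → true)) (count-mono z⊆p)
    where
    z⊆p : ∀ w → (z == w) ∧ true ≡ true → p w ≡ true
    z⊆p w z==w = subst (λ w → p w ≡ true) (==⇒≡ (trans (sym (∧-identityʳ _)) z==w)) pz

  count-strict-mono : {p q : Fin n → Bool} → (∀ z → p z ≡ true → q z ≡ true) →
                      {x : Fin n} → q x ≡ true → p x ≡ false → count p < count q
  count-strict-mono {p} {q} p⊆q {x} qx px =
    ≤-trans (≤-reflexive (+-comm 1 (count p)))
      (≤-trans (+-monoʳ-≤ (count p) (𝟙≤count (λ z → q z ∧ not (p z)) new))
               (≤-reflexive (sym (count-with-subset p⊆q))))
    where
    new : q x ∧ not (p x) ≡ true
    new rewrite qx | px = refl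

module _ {n k : ℕ} (part : Fin n → Fin k) {m : ℕ} (fibre-size : ∀ i → count (λ z → part z == i) ≡ m) where

  count-fibres : (h : Fin k → Bool) → count (λ z → h (part z)) ≡ m * count h
  count-fibres h = begin
    count (λ z → h (part z))                          ≡⟨ count≡∑ (λ z → h (part z)) ⟩
    ∑[ z < n ] 𝟙 (h (part z))                         ≡⟨ sum-cong-≗ (λ z → ∑-indicator (part z) h) ⟨
    ∑[ z < n ] ∑[ w < k ] 𝟙 ((part z == w) ∧ h w)     ≡⟨ ∑-comm (λ z w → 𝟙 ((part z == w) ∧ h w)) ⟩
    ∑[ w < k ] ∑[ z < n ] 𝟙 ((part z == w) ∧ h w)
      ≡⟨ sum-cong-≗ (λ w → sum-cong-≗ (λ z → 𝟙-∧ (part z == w) (h w))) ⟩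
    ∑[ w < k ] ∑[ z < n ] (𝟙 (part z == w) * 𝟙 (h w))
      ≡⟨ sum-cong-≗ (λ w → *-distribʳ-sum (𝟙 (h w)) (λ z → 𝟙 (part z == w))) ⟨
    ∑[ w < k ] (∑[ z < n ] 𝟙 (part z == w) * 𝟙 (h w))
      ≡⟨ sum-cong-≗ (λ w → cong (_* 𝟙 (h w)) (trans (sym (count≡∑ (λ z → part z == w))) (fibre-size w))) ⟩
    ∑[ w < k ] (m * 𝟙 (h w))                          ≡⟨ *-distribˡ-sum m (𝟙 ∘ h) ⟨
    m * ∑[ w < k ] 𝟙 (h w)                            ≡⟨ cong (m *_) (count≡∑ h) ⟨
    m * count h                                       ∎
    where open ≡-Reasoning

-- Relations between adjacent vertices, and distances

data Rel : Set where
  edge fwd bwd : Rel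

rev : Rel → Rel
rev edge = edge
rev fwd  = bwd
rev bwd  = fwd

sumRel : (Rel → ℕ) → ℕ
sumRel f = f edge + f fwd + f bwd

sumRel-cong : {f g : Rel → ℕ} → (∀ T → f T ≡ g T) → sumRel f ≡ sumRel g
sumRel-cong eq = cong₂ _+_ (cong₂ _+_ (eq edge) (eq fwd)) (eq bwd)

sumRel-rev : (f : Rel → ℕ) → sumRel (f ∘ rev) ≡ sumRel f
sumRel-rev f = xy∙z≈xz∙y (f edge) (f bwd) (f fwd)

rev-involutive : ∀ T → rev (rev T) ≡ T
rev-involutive edge = refl
rev-involutive fwd  = refl
rev-involutive bwd  = refl

equal-rows⇒fwd≡bwd : (f : Rel → Rel → ℕ) → (∀ T V → f T V ≡ f (rev T) (rev V)) →
                     ∀ {T U} → T ≢ U → (∀ V → f T V ≡ f U V) → ∀ S → f S fwd ≡ f S bwd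
equal-rows⇒fwd≡bwd f f-rev {T} {U} T≢U rows = columns
  where
  open ≡-Reasoning
  fwd-row : ∀ {T U} → T ≢ U → (∀ V → f T V ≡ f U V) → f fwd fwd ≡ f fwd bwd
  fwd-row {edge} {edge} ne _ = contradiction refl ne
  fwd-row {fwd}  {fwd}  ne _ = contradiction refl ne
  fwd-row {bwd}  {bwd}  ne _ = contradiction refl ne
  fwd-row {edge} {fwd}  _  h = begin
    f fwd fwd   ≡⟨ h fwd ⟨
    f edge fwd  ≡⟨ f-rev edge fwd ⟩
    f edge bwd  ≡⟨ h bwd ⟩
    f fwd bwd   ∎
  fwd-row {edge} {bwd}  _  h = begin
    f fwd fwd   ≡⟨ f-rev fwd fwd ⟩
    f bwd bwd   ≡⟨ h bwd ⟨
    f edge bwd  ≡⟨ f-rev edge fwd ⟨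
    f edge fwd  ≡⟨ h fwd ⟩
    f bwd fwd   ≡⟨ f-rev bwd fwd ⟩
    f fwd bwd   ∎
  fwd-row {fwd}  {bwd}  _  h = trans (h fwd) (f-rev bwd fwd)
  fwd-row {fwd}  {edge} _  h = fwd-row {edge} {fwd} (λ ()) (sym ∘ h)
  fwd-row {bwd}  {edge} _  h = fwd-row {edge} {bwd} (λ ()) (sym ∘ h)
  fwd-row {bwd}  {fwd}  _  h = fwd-row {fwd} {bwd} (λ ()) (sym ∘ h)
  columns : ∀ S → f S fwd ≡ f S bwd
  columns edge = f-rev edge fwd
  columns fwd  = fwd-row T≢U rows
  columns bwd  = begin
    f bwd fwd   ≡⟨ f-rev bwd fwd ⟩
    f fwd bwd   ≡⟨ fwd-row T≢U rows ⟨
    f fwd fwd   ≡⟨ f-rev fwd fwd ⟩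
    f bwd bwd   ∎

code : Rel → Bool × Bool
code edge = true  , true
code fwd  = true  , false
code bwd  = false , true

code-injective : ∀ {T U} → code T ≡ code U → T ≡ U
code-injective {edge} {edge} _ = refl
code-injective {fwd}  {fwd}  _ = refl
code-injective {bwd}  {bwd}  _ = refl

O : Maybe ℕ × Maybe ℕ
O = just 0 , just 0

module _ {n : ℕ} (G : Digraph n) where

  arcs : Fin n → Fin n → Bool × Bool
  arcs x y = arc G x y , arc G y x

  rel : Rel → Fin n → Fin n → Bool
  rel edge    = A₀ G
  rel fwd     = A₁ G
  rel bwd x y = A₁ G y x

  rel-rev : ∀ T x y → rel (rev T) x y ≡ rel T y x
  rel-rev edge x y = ∧-comm (arc G x y) (arc G y x)
  rel-rev fwd  x y = refl
  rel-rev bwd  x y = refl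

  arc⇒≢ : ∀ {x y} → arc G x y ≡ true → x ≢ y
  arc⇒≢ {x} xy refl = contradiction (trans (sym (irrefl G x)) xy) λ ()

  rel⇒arcs : ∀ T x y → rel T x y ≡ true → arcs x y ≡ code T
  rel⇒arcs edge x y r with arc G x y | arc G y x
  ... | true  | true  = refl
  rel⇒arcs fwd  x y r with arc G x y | arc G y x
  ... | true  | false = refl
  rel⇒arcs bwd  x y r with arc G x y | arc G y x
  ... | false | true  = refl

  rel-functional : ∀ {T U} x y → rel T x y ≡ true → rel U x y ≡ true → T ≡ U
  rel-functional {T} {U} x y r r′ = code-injective (trans (sym (rel⇒arcs T x y r)) (rel⇒arcs U x y r′))

  adj⇒rel : ∀ x y → adj G x y ≡ true → ∃[ T ] rel T x y ≡ true
  adj⇒rel x y x~y with arc G x y in a | arc G y x in a′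
  ... | true  | true  = edge , cong₂ _∧_ a a′
  ... | true  | false = fwd  , cong₂ (λ u v → u ∧ not v) a a′
  ... | false | true  = bwd  , cong₂ (λ u v → u ∧ not v) a′ a
  ... | false | false = contradiction x~y λ ()

  ¬adj⇒arcs : ∀ x y → adj G x y ≡ false → arcs x y ≡ (false , false)
  ¬adj⇒arcs x y x≁y = cong₂ _,_ (∨-conicalˡ _ _ x≁y) (∨-conicalʳ _ _ x≁y)

  𝟙-adj : ∀ b x y → 𝟙 (b ∧ adj G x y) ≡ sumRel (λ T → 𝟙 (b ∧ rel T x y))
  𝟙-adj b x y = table b (arc G x y) (arc G y x)
    where
    table : ∀ b a a′ →
            𝟙 (b ∧ (a ∨ a′)) ≡ 𝟙 (b ∧ (a ∧ a′)) + 𝟙 (b ∧ (a ∧ not a′)) + 𝟙 (b ∧ (a′ ∧ not a))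
    table false _     _     = refl
    table true  false false = refl
    table true  false true  = refl
    table true  true  false = refl
    table true  true  true  = refl

  𝟙-out : ∀ b x y → 𝟙 (b ∧ arc G x y) ≡ 𝟙 (b ∧ rel edge x y) + 𝟙 (b ∧ rel fwd x y)
  𝟙-out b x y = table b (arc G x y) (arc G y x)
    where
    table : ∀ b a a′ → 𝟙 (b ∧ a) ≡ 𝟙 (b ∧ (a ∧ a′)) + 𝟙 (b ∧ (a ∧ not a′))
    table false _     _     = refl
    table true  false _     = refl
    table true  true  false = refl
    table true  true  true  = refl

  𝟙-in : ∀ b x y → 𝟙 (b ∧ arc G y x) ≡ 𝟙 (b ∧ rel edge x y) + 𝟙 (b ∧ rel bwd x y)
  𝟙-in b x y = table b (arc G x y) (arc G y x)
    where
    table : ∀ b a a′ → 𝟙 (b ∧ a′) ≡ 𝟙 (b ∧ (a ∧ a′)) + 𝟙 (b ∧ (a′ ∧ not a))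
    table false _     _     = refl
    table true  false false = refl
    table true  true  false = refl
    table true  false true  = refl
    table true  true  true  = refl

  pRel : Rel → Rel → Fin n → Fin n → ℕ
  pRel T U x y = count (λ z → rel T x z ∧ rel U z y)

  valency : Rel → Fin n → ℕ
  valency T x = count (rel T x)

  pRel-rev : ∀ T U x y → pRel (rev T) U y x ≡ pRel (rev U) T x y
  pRel-rev T U x y = count-cong λ z →
    trans (cong₂ _∧_ (rel-rev T y z) (sym (rel-rev U x z))) (∧-comm (rel T z y) _)

  valency≡pRel : ∀ T x → valency T x ≡ pRel T (rev T) x x
  valency≡pRel T x = count-cong λ z →
    trans (sym (∧-idem (rel T x z))) (cong (rel T x z ∧_) (sym (rel-rev T z x)))

  pRel-diagonal : ∀ T U → T ≢ rev U → ∀ x → pRel T U x x ≡ 0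
  pRel-diagonal T U T≢rU x = count-false _ λ z → ¬-not λ both →
    T≢rU (rel-functional x z (∧-conicalˡ _ _ both) (trans (rel-rev U x z) (∧-conicalʳ _ _ both)))

  walk-suc⁺ : ∀ {d x y} z → arc G x z ≡ true → walk G d z y ≡ true → walk G (suc d) x y ≡ true
  walk-suc⁺ z xz zy = any-allFin⁺ _ {z} (cong₂ _∧_ xz zy)

  walk-suc⁻ : ∀ {d x y} → walk G (suc d) x y ≡ true → ∃[ z ] arc G x z ≡ true × walk G d z y ≡ true
  walk-suc⁻ w with z , xzy ← any-allFin⁻ _ w = z , ∧-conicalˡ _ _ xzy , ∧-conicalʳ _ _ xzy

  walk₁ : ∀ x y → walk G 1 x y ≡ arc G x y
  walk₁ x y = bool-ext to from
    where
    to : walk G 1 x y ≡ true → arc G x y ≡ true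
    to w with z , xz , z==y ← walk-suc⁻ {0} w = subst (λ z → arc G x z ≡ true) (==⇒≡ z==y) xz
    from : arc G x y ≡ true → walk G 1 x y ≡ true
    from xy = walk-suc⁺ {0} y xy (==-refl y)

  search-sound : ∀ d f x y {r} → search G d f x y ≡ just r → walk G r x y ≡ true
  search-sound d (suc f) x y eq with walk G d x y in w
  ... | true  = subst (λ r → walk G r x y ≡ true) (just-injective eq) w
  ... | false = search-sound (suc d) f x y eq

  ∂-refl : ∀ x → ∂ G x x ≡ just 0
  ∂-refl x rewrite ==-refl x = refl

  ∂̃-refl : ∀ x → ∂̃ G x x ≡ O
  ∂̃-refl x = cong₂ _,_ (∂-refl x) (∂-refl x)

  ∂≡0⇒≡ : ∀ {x y} → ∂ G x y ≡ just 0 → x ≡ y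
  ∂≡0⇒≡ {x} {y} eq = ==⇒≡ (search-sound 0 (suc n) x y eq)

  ∂≡1⇒arc : ∀ {x y} → ∂ G x y ≡ just 1 → arc G x y ≡ true
  ∂≡1⇒arc {x} {y} eq = trans (sym (walk₁ x y)) (search-sound 0 (suc n) x y eq)

  ∂≡2⇒path : ∀ {x y} → ∂ G x y ≡ just 2 → ∃[ z ] arc G x z ≡ true × arc G z y ≡ true
  ∂≡2⇒path {x} {y} eq with z , xz , zy ← walk-suc⁻ {1} (search-sound 0 (suc n) x y eq) =
    z , xz , trans (sym (walk₁ z y)) zy

rel-cong : ∀ {n m} (G : Digraph n) (H : Digraph m) {x y x′ y′} →
           arc G x y ≡ arc H x′ y′ → arc G y x ≡ arc H y′ x′ → ∀ T → rel G T x y ≡ rel H T x′ y′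
rel-cong G H xy yx edge = cong₂ _∧_ xy yx
rel-cong G H xy yx fwd  = cong₂ (λ u v → u ∧ not v) xy yx
rel-cong G H xy yx bwd  = cong₂ (λ u v → u ∧ not v) yx xy

arc⇒∂≡1 : ∀ {n} (G : Digraph n) {x y} → arc G x y ≡ true → ∂ G x y ≡ just 1
arc⇒∂≡1 {suc n} G {x} {y} xy rewrite ==-false (arc⇒≢ G xy) | walk₁ G x y | xy = refl

path⇒∂≡2 : ∀ {n} (G : Digraph n) {x y} z → x ≢ y → arc G x y ≡ false →
           arc G x z ≡ true → arc G z y ≡ true → ∂ G x y ≡ just 2
path⇒∂≡2 {suc zero}    G {zero} {zero} _ x≢y _ _ _ = contradiction refl x≢y
path⇒∂≡2 {suc (suc n)} G {x} {y} z x≢y ¬xy xz zy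
  rewrite ==-false x≢y | walk₁ G x y | ¬xy | walk-suc⁺ G {1} z xz (trans (walk₁ G z y) zy) = refl

∂≡2⇒¬arc : ∀ {n} (G : Digraph n) {x y} → ∂ G x y ≡ just 2 → arc G x y ≡ false
∂≡2⇒¬arc G {x} {y} eq = ¬-not λ xy → contradiction (trans (sym eq) (arc⇒∂≡1 G xy)) λ ()

cls : Rel → Maybe ℕ × Maybe ℕ
cls edge = just 1 , just 1
cls fwd  = just 1 , just 2
cls bwd  = just 2 , just 1

-- The equality test used inside Defs.p, so that p G a b x y unfolds to a count of does (_ ≟ᶜ _).
_≟ᶜ_ : DecidableEquality (Maybe ℕ × Maybe ℕ)
_≟ᶜ_ = ×-≡-dec (Maybe-≡-dec _≟ℕ_) (Maybe-≡-dec _≟ℕ_)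

module _ {n : ℕ} (G : Digraph n) where

  ∂̃≟O : ∀ x y → does (∂̃ G x y ≟ᶜ O) ≡ (x == y)
  ∂̃≟O x y = does-reflects (∂̃ G x y ≟ᶜ O)
    (λ eq → subst (λ y → (x == y) ≡ true) (∂≡0⇒≡ G (proj₁ (,-injective eq))) (==-refl x))
    (λ x==y → subst (λ y → ∂̃ G x y ≡ O) (==⇒≡ x==y) (∂̃-refl G x))

  p-O-left : ∀ b x y → p G O b x y ≡ 𝟙 (does (∂̃ G x y ≟ᶜ b))
  p-O-left b x y = trans (count-cong λ z → cong (_∧ _) (∂̃≟O x z)) (count-== x (λ z → does (∂̃ G z y ≟ᶜ b)))

  p-O-right : ∀ a x y → p G a O x y ≡ 𝟙 (does (∂̃ G x y ≟ᶜ a))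
  p-O-right a x y = trans (count-cong λ z → trans (cong (_ ∧_) (trans (∂̃≟O z y) (==-sym z y)))
                                                  (∧-comm (does (∂̃ G x z ≟ᶜ a)) (y == z)))
                          (count-== y (λ z → does (∂̃ G x z ≟ᶜ a)))

module _ {n : ℕ} (G : Digraph n) (one-way⇒∂≡2 : ∀ x y → A₁ G x y ≡ true → ∂ G y x ≡ just 2) where

  ∂̃≡cls⇒rel : ∀ T x y → ∂̃ G x y ≡ cls T → rel G T x y ≡ true
  ∂̃≡cls⇒rel T x y eq with e , e′ ← ,-injective eq | T
  ... | edge = cong₂ _∧_ (∂≡1⇒arc G e) (∂≡1⇒arc G e′)
  ... | fwd  = cong₂ (λ u v → u ∧ not v) (∂≡1⇒arc G e) (∂≡2⇒¬arc G e′)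
  ... | bwd  = cong₂ (λ u v → u ∧ not v) (∂≡1⇒arc G e′) (∂≡2⇒¬arc G e)

  rel⇒∂̃≡cls : ∀ T x y → rel G T x y ≡ true → ∂̃ G x y ≡ cls T
  rel⇒∂̃≡cls edge x y r = cong₂ _,_ (arc⇒∂≡1 G (∧-conicalˡ _ _ r)) (arc⇒∂≡1 G (∧-conicalʳ _ _ r))
  rel⇒∂̃≡cls fwd  x y r = cong₂ _,_ (arc⇒∂≡1 G (∧-conicalˡ _ _ r)) (one-way⇒∂≡2 x y r)
  rel⇒∂̃≡cls bwd  x y r = cong₂ _,_ (one-way⇒∂≡2 y x r) (arc⇒∂≡1 G (∧-conicalˡ _ _ r))

  ∂̃≟cls : ∀ T x y → does (∂̃ G x y ≟ᶜ cls T) ≡ rel G T x y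
  ∂̃≟cls T x y = does-reflects (∂̃ G x y ≟ᶜ cls T) (∂̃≡cls⇒rel T x y) (rel⇒∂̃≡cls T x y)

  p-cls : ∀ T U x y → p G (cls T) (cls U) x y ≡ pRel G T U x y
  p-cls T U x y = count-cong λ z → cong₂ _∧_ (∂̃≟cls T x z) (∂̃≟cls U z y)

girth-two : ∀ {n} (G : Digraph n) {x y} → arc G x y ≡ true → arc G y x ≡ true → Girth G 2
girth-two G {x} {y} xy yx = (circuit , arcs-along , refl , injective) , no-loop
  where
  circuit : ℕ → Fin _
  circuit 1 = y
  circuit _ = x
  arcs-along : ∀ i → i < 2 → arc G (circuit i) (circuit (suc i)) ≡ true
  arcs-along 0 _ = xy
  arcs-along 1 _ = yx
  arcs-along (suc (suc _)) (s≤s (s≤s ()))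
  injective : ∀ i j → i < 2 → j < 2 → circuit i ≡ circuit j → i ≡ j
  injective 0 0 _ _ _ = refl
  injective 1 1 _ _ _ = refl
  injective 0 1 _ _ x≡y = contradiction x≡y (arc⇒≢ G xy)
  injective 1 0 _ _ y≡x = contradiction y≡x (arc⇒≢ G yx)
  injective (suc (suc _)) _ (s≤s (s≤s ())) _ _
  injective _ (suc (suc _)) _ (s≤s (s≤s ())) _
  no-loop : ∀ g → 1 ≤ g → g < 2 → ¬ HasCircuit G g
  no-loop 1 _ _ (c , along , closed , _) = arc⇒≢ G (along 0 (s≤s z≤n)) (sym closed)
  no-loop (suc (suc _)) _ (s≤s (s≤s ()))

-- Coclique extensions

injective⇒surjective : ∀ {a} (f : Fin a → Fin a) → Injective _≡_ _≡_ f → ∀ y → ∃[ x ] f x ≡ y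
injective⇒surjective {suc a} f f-injective y with any? (λ x → f x ≟ᶠ y)
... | yes found = found
... | no  none  = contradiction (injective⇒≤ punched-injective) 1+n≰n
  where
  punched : Fin (suc a) → Fin a
  punched x = punchOut {i = y} {j = f x} (λ y≡fx → none (x , sym y≡fx))
  punched-injective : Injective _≡_ _≡_ punched
  punched-injective {x} {x′} eq =
    f-injective (punchOut-injective {i = y} (λ e → none (x , sym e)) (λ e → none (x′ , sym e)) eq)

injective⇒inverse : ∀ {a b} → a ≡ b → (f : Fin a → Fin b) → Injective _≡_ _≡_ f →
                    Σ (Fin a ↔ Fin b) λ F → ∀ x → Inverse.to F x ≡ f x
injective⇒inverse refl f f-injective =
  mk↔ₛ′ f (proj₁ ∘ surjective) (proj₂ ∘ surjective) (λ x → f-injective (proj₂ (surjective (f x)))) ,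
  λ _ → refl
  where
  surjective : ∀ y → ∃[ x ] f x ≡ y
  surjective = injective⇒surjective f f-injective

module _ {n k m : ℕ} (part : Fin n → Fin k) (fibre-size : ∀ i → count (λ z → part z == i) ≡ m) where

  vertex-count : n ≡ k * m
  vertex-count = begin
    n                         ≡⟨ count-true ⟨
    count (λ (_ : Fin n) → true) ≡⟨ count-fibres part fibre-size (λ _ → true) ⟩
    m * count (λ (_ : Fin k) → true) ≡⟨ cong (m *_) count-true ⟩
    m * k                     ≡⟨ *-comm m k ⟩
    k * m                     ∎
    where open ≡-Reasoning

  rank : Fin n → ℕ
  rank x = count (λ y → does (y <?ᶠ x) ∧ (part y == part x))

  rank-<-mono : ∀ {x y} → part x ≡ part y → toℕ x < toℕ y → rank x < rank y
  rank-<-mono {x} {y} same x<y = count-strict-mono earlier {x}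
    (cong₂ _∧_ (dec-true (x <?ᶠ y) x<y) (dec-true (part x ≟ᶠ part y) same))
    (cong (_∧ (part x == part x)) (dec-false (x <?ᶠ x) (<ᶠ-irrefl refl)))
    where
    earlier : ∀ z → does (z <?ᶠ x) ∧ (part z == part x) ≡ true → does (z <?ᶠ y) ∧ (part z == part y) ≡ true
    earlier z e = cong₂ _∧_ (dec-true (z <?ᶠ y) (<ᶠ-trans (does⇒ (z <?ᶠ x) (∧-conicalˡ _ _ e)) x<y))
                            (dec-true (part z ≟ᶠ part y) (trans (==⇒≡ (∧-conicalʳ _ _ e)) same))

  rank<m : ∀ x → rank x < m
  rank<m x = subst (rank x <_) (fibre-size (part x))
    (count-strict-mono (λ z e → ∧-conicalʳ _ _ e) {x} (==-refl (part x))
      (cong (_∧ (part x == part x)) (dec-false (x <?ᶠ x) (<ᶠ-irrefl refl))))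

  index : Fin n → Fin (k * m)
  index x = combine (part x) (fromℕ< (rank<m x))

  index-injective : Injective _≡_ _≡_ index
  index-injective {x} {y} eq
    with same , same-index ← combine-injective _ _ _ _ eq
    with same-rank ← fromℕ<-injective (rank x) (rank y) (rank<m x) (rank<m y) same-index
    with <-cmp x y
  ... | tri≈ _ x≡y _ = x≡y
  ... | tri< x<y _ _ = contradiction same-rank (<⇒≢ (rank-<-mono same x<y))
  ... | tri> _ _ y<x = contradiction (sym same-rank) (<⇒≢ (rank-<-mono (sym same) y<x))

≅-cocliqueExt : ∀ {n k m} (G : Digraph n) (S : Digraph k) (part : Fin n → Fin k) →
                (∀ i → count (λ z → part z == i) ≡ m) →
                (∀ x y → arc G x y ≡ arc S (part x) (part y)) → G ≅ cocliqueExt S m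
≅-cocliqueExt {m = m} G S part fibre-size arc-part
  with F , to≡index ← injective⇒inverse (vertex-count part fibre-size) (index part fibre-size)
                                         (index-injective part fibre-size)
  = F , λ x y → begin
    arc S (proj₁ (remQuot m (Inverse.to F x))) (proj₁ (remQuot m (Inverse.to F y)))
      ≡⟨ cong₂ (λ u v → arc S (proj₁ (remQuot m u)) (proj₁ (remQuot m v))) (to≡index x) (to≡index y) ⟩
    arc S (proj₁ (remQuot m (index part fibre-size x))) (proj₁ (remQuot m (index part fibre-size y)))
      ≡⟨ cong₂ (λ u v → arc S (proj₁ u) (proj₁ v)) (remQuot-combine _ _) (remQuot-combine _ _) ⟩
    arc S (part x) (part y)
      ≡⟨ arc-part x y ⟨
    arc G x y ∎
  where open ≡-Reasoning

-- Semicomplete multipartite commutative weakly distance-regular digraphs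

module WDRMultipartite
  {n k : ℕ} (Γ : Digraph n) (part : Fin n → Fin k)
  (multipartite : ∀ x y → (adj Γ x y ≡ true → part x ≢ part y) × (part x ≢ part y → adj Γ x y ≡ true))
  (parts≥2 : ∀ i → 2 ≤ count (λ x → part x == i))
  (wdr : WeaklyDistanceRegular Γ)
  (commutative : Commutative Γ)
  (classes : ∀ d → In∂̃ Γ (just 1 , just d) ⇔ (suc d ≡ 2 ⊎ suc d ≡ 3))
  where

  open ≡-Reasoning

  strongly-connected : StronglyConnected Γ
  strongly-connected = proj₁ wdr

  ¬adj⇒same-part : ∀ {x y} → adj Γ x y ≡ false → part x ≡ part y
  ¬adj⇒same-part {x} {y} x≁y = decidable-stable (part x ≟ᶠ part y) λ differ →
    contradiction (trans (sym x≁y) (proj₂ (multipartite x y) differ)) λ ()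

  same-part≡¬adj : ∀ x y → (part x == part y) ≡ not (adj Γ x y)
  same-part≡¬adj x y = bool-ext
    (λ same → ¬-not λ x≁y → proj₁ (multipartite x y) (not-injective x≁y) (==⇒≡ same))
    (λ x≁y → dec-true (part x ≟ᶠ part y) (¬adj⇒same-part (not-injective x≁y)))

  same-part⇒¬arc : ∀ {x y} → part x ≡ part y → arc Γ x y ≡ false
  same-part⇒¬arc {x} {y} same = ∨-conicalˡ _ _
    (not-injective (trans (sym (same-part≡¬adj x y)) (dec-true (part x ≟ᶠ part y) same)))

  adj-part : ∀ {x y y′} → part y ≡ part y′ → adj Γ x y ≡ adj Γ x y′
  adj-part {x} {y} {y′} same = not-injective (begin
    not (adj Γ x y)      ≡⟨ same-part≡¬adj x y ⟨
    (part x == part y)   ≡⟨ cong (part x ==_) same ⟩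
    (part x == part y′)  ≡⟨ same-part≡¬adj x y′ ⟩
    not (adj Γ x y′)     ∎)

  rep : Fin k → Fin n
  rep i = proj₁ (count-witness (λ x → part x == i) (≤-trans (s≤s z≤n) (parts≥2 i)))

  part-rep : ∀ i → part (rep i) ≡ i
  part-rep i = ==⇒≡ (proj₂ (count-witness (λ x → part x == i) (≤-trans (s≤s z≤n) (parts≥2 i))))

  rep-adjacent : ∀ {x j} → part x ≢ j → adj Γ x (rep j) ≡ true
  rep-adjacent {x} {j} x∉j = proj₂ (multipartite x (rep j)) (x∉j ∘ flip trans (part-rep j))

  one-way⇒∂≡2 : ∀ x y → A₁ Γ x y ≡ true → ∂ Γ y x ≡ just 2
  one-way⇒∂≡2 x y r with d , ∂yx≡d ← strongly-connected y x
             with Equivalence.to (classes d) (x , y , cong₂ _,_ (arc⇒∂≡1 Γ (∧-conicalˡ _ _ r)) ∂yx≡d)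
  ... | inj₁ refl = contradiction (subst (λ b → not b ≡ true) (∂≡1⇒arc Γ ∂yx≡d) (∧-conicalʳ _ _ r)) λ ()
  ... | inj₂ refl = ∂yx≡d

  cls-occurs : ∀ T → In∂̃ Γ (cls T)
  cls-occurs edge = Equivalence.from (classes 1) (inj₁ refl)
  cls-occurs fwd  = Equivalence.from (classes 2) (inj₂ refl)
  cls-occurs bwd with x , y , eq ← cls-occurs fwd = y , x , cong swap eq

  src tgt : Rel → Fin n
  src T = proj₁ (cls-occurs T)
  tgt T = proj₁ (proj₂ (cls-occurs T))

  src-tgt : ∀ T → rel Γ T (src T) (tgt T) ≡ true
  src-tgt T = ∂̃≡cls⇒rel Γ one-way⇒∂≡2 T _ _ (proj₂ (proj₂ (cls-occurs T)))

  same-class : ∀ T {x y x′ y′} → rel Γ T x y ≡ true → rel Γ T x′ y′ ≡ true → ∂̃ Γ x y ≡ ∂̃ Γ x′ y′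
  same-class T r r′ =
    trans (rel⇒∂̃≡cls Γ one-way⇒∂≡2 T _ _ r) (sym (rel⇒∂̃≡cls Γ one-way⇒∂≡2 T _ _ r′))

  pRel-∂̃ : ∀ T U {x y x′ y′} → ∂̃ Γ x y ≡ ∂̃ Γ x′ y′ → pRel Γ T U x y ≡ pRel Γ T U x′ y′
  pRel-∂̃ T U {x} {y} {x′} {y′} eq = begin
    pRel Γ T U x y              ≡⟨ p-cls Γ one-way⇒∂≡2 T U x y ⟨
    p Γ (cls T) (cls U) x y     ≡⟨ proj₂ (proj₂ wdr) _ _ _ (cls-occurs T) (cls-occurs U) (x , y , refl)
                                                   x y x′ y′ refl (sym eq) ⟩
    p Γ (cls T) (cls U) x′ y′   ≡⟨ p-cls Γ one-way⇒∂≡2 T U x′ y′ ⟩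
    pRel Γ T U x′ y′            ∎

  pRel-comm : ∀ T U x y → pRel Γ T U x y ≡ pRel Γ U T x y
  pRel-comm T U x y = begin
    pRel Γ T U x y             ≡⟨ p-cls Γ one-way⇒∂≡2 T U x y ⟨
    p Γ (cls T) (cls U) x y    ≡⟨ commutative _ _ (cls-occurs T) (cls-occurs U) x y ⟩
    p Γ (cls U) (cls T) x y    ≡⟨ p-cls Γ one-way⇒∂≡2 U T x y ⟩
    pRel Γ U T x y             ∎

  valency-const : ∀ T x y → valency Γ T x ≡ valency Γ T y
  valency-const T x y = begin
    valency Γ T x              ≡⟨ valency≡pRel Γ T x ⟩
    pRel Γ T (rev T) x x       ≡⟨ pRel-∂̃ T (rev T) (trans (∂̃-refl Γ x) (sym (∂̃-refl Γ y))) ⟩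
    pRel Γ T (rev T) y y       ≡⟨ valency≡pRel Γ T y ⟨
    valency Γ T y              ∎

  valency-rev : ∀ T x → valency Γ (rev T) x ≡ valency Γ T x
  valency-rev T x = begin
    valency Γ (rev T) x              ≡⟨ valency≡pRel Γ (rev T) x ⟩
    pRel Γ (rev T) (rev (rev T)) x x ≡⟨ cong (λ U → pRel Γ (rev T) U x x) (rev-involutive T) ⟩
    pRel Γ (rev T) T x x             ≡⟨ pRel-comm (rev T) T x x ⟩
    pRel Γ T (rev T) x x             ≡⟨ valency≡pRel Γ T x ⟨
    valency Γ T x                    ∎

  deg : Rel → Fin n → Fin k → ℕ
  deg T x j = count (λ z → (part z == j) ∧ rel Γ T x z)

  valency-split : ∀ T x y → valency Γ T x ≡ deg T x (part y) + sumRel (λ U → pRel Γ T U x y)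
  valency-split T x y = begin
    valency Γ T x                                                ≡⟨ count-split (rel Γ T x) (λ z → adj Γ z y) ⟩
    count (λ z → rel Γ T x z ∧ adj Γ z y) + count (λ z → rel Γ T x z ∧ not (adj Γ z y))
                                                                 ≡⟨ cong₂ _+_ adjacent non-adjacent ⟩
    sumRel (λ U → pRel Γ T U x y) + deg T x (part y)            ≡⟨ +-comm (sumRel (λ U → pRel Γ T U x y)) _ ⟩
    deg T x (part y) + sumRel (λ U → pRel Γ T U x y)            ∎
    where
    adjacent : count (λ z → rel Γ T x z ∧ adj Γ z y) ≡ sumRel (λ U → pRel Γ T U x y)
    adjacent = count-+₃ (λ z → 𝟙-adj Γ (rel Γ T x z) z y)
    non-adjacent : count (λ z → rel Γ T x z ∧ not (adj Γ z y)) ≡ deg T x (part y)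
    non-adjacent = count-cong λ z →
      trans (∧-comm (rel Γ T x z) _) (cong (_∧ rel Γ T x z) (sym (same-part≡¬adj z y)))

  deg-∂̃ : ∀ T {x y x′ y′} → ∂̃ Γ x y ≡ ∂̃ Γ x′ y′ → deg T x (part y) ≡ deg T x′ (part y′)
  deg-∂̃ T {x} {y} {x′} {y′} eq = +-cancelʳ-≡ _ _ _ (begin
    deg T x (part y) + sumRel (λ U → pRel Γ T U x y)     ≡⟨ valency-split T x y ⟨
    valency Γ T x                                        ≡⟨ valency-const T x x′ ⟩
    valency Γ T x′                                       ≡⟨ valency-split T x′ y′ ⟩
    deg T x′ (part y′) + sumRel (λ U → pRel Γ T U x′ y′)
      ≡⟨ cong (deg T x′ (part y′) +_) (sumRel-cong λ U → pRel-∂̃ T U eq) ⟨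
    deg T x′ (part y′) + sumRel (λ U → pRel Γ T U x y)   ∎)

  -- Commutativity enters here: 2-walks x → z → y are counted from x in the first sum and from y in the second.
  deg-rev : ∀ T x y → deg T x (part y) ≡ deg (rev T) y (part x)
  deg-rev T x y = +-cancelʳ-≡ _ _ _ (begin
    deg T x (part y) + sumRel (λ U → pRel Γ T U x y)         ≡⟨ valency-split T x y ⟨
    valency Γ T x                                            ≡⟨ valency-const T x y ⟩
    valency Γ T y                                            ≡⟨ valency-rev T y ⟨
    valency Γ (rev T) y                                      ≡⟨ valency-split (rev T) y x ⟩
    deg (rev T) y (part x) + sumRel (λ U → pRel Γ (rev T) U y x) ≡⟨ cong (deg (rev T) y (part x) +_) walks-back ⟩
    deg (rev T) y (part x) + sumRel (λ U → pRel Γ T U x y)   ∎)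
    where
    walks-back : sumRel (λ U → pRel Γ (rev T) U y x) ≡ sumRel (λ U → pRel Γ T U x y)
    walks-back = begin
      sumRel (λ U → pRel Γ (rev T) U y x)   ≡⟨ sumRel-cong (λ U → pRel-rev Γ T U x y) ⟩
      sumRel (λ U → pRel Γ (rev U) T x y)   ≡⟨ sumRel-cong (λ U → pRel-comm (rev U) T x y) ⟩
      sumRel (λ U → pRel Γ T (rev U) x y)   ≡⟨ sumRel-rev (λ U → pRel Γ T U x y) ⟩
      sumRel (λ U → pRel Γ T U x y)         ∎

  deg-part-invariant : ∀ T {x x′} j → part x ≡ part x′ → deg T x j ≡ deg T x′ j
  deg-part-invariant T {x} {x′} j same = subst (λ j → deg T x j ≡ deg T x′ j) (part-rep j) (begin
    deg T x (part (rep j))         ≡⟨ deg-rev T x (rep j) ⟩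
    deg (rev T) (rep j) (part x)   ≡⟨ cong (deg (rev T) (rep j)) same ⟩
    deg (rev T) (rep j) (part x′)  ≡⟨ deg-rev T x′ (rep j) ⟨
    deg T x′ (part (rep j))        ∎)

  in-flow : ∀ x y → valency Γ bwd y ≡ deg bwd y (part x) + sumRel (λ U → pRel Γ U fwd x y)
  in-flow x y = trans (valency-split bwd y x) (cong (deg bwd y (part x) +_)
    (trans (sumRel-cong λ U → pRel-rev Γ fwd U x y) (sumRel-rev (λ U → pRel Γ U fwd x y))))

  part-size-split : ∀ x j → part x ≢ j → count (λ z → part z == j) ≡ sumRel (λ T → deg T x j)
  part-size-split x j x∉j = trans (count-cong in-j⇒adjacent) (count-+₃ λ z → 𝟙-adj Γ (part z == j) x z)
    where
    in-j⇒adjacent : ∀ z → (part z == j) ≡ (part z == j) ∧ adj Γ x z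
    in-j⇒adjacent z with part z == j in z∈j
    ... | false = refl
    ... | true  = sym (proj₂ (multipartite x z) (x∉j ∘ flip trans (==⇒≡ z∈j)))

  vertex-split : ∀ x → n ≡ sumRel (λ T → valency Γ T x) + count (λ z → part z == part x)
  vertex-split x = begin
    n                                                           ≡⟨ count-true {n} ⟨
    count (λ (_ : Fin n) → true)                                ≡⟨ count-split (λ _ → true) (adj Γ x) ⟩
    count (adj Γ x) + count (λ z → not (adj Γ x z))             ≡⟨ cong₂ _+_ (count-+₃ (𝟙-adj Γ true x))
                                                                              (count-cong non-adjacent) ⟩
    sumRel (λ T → valency Γ T x) + count (λ z → part z == part x) ∎
    where
    non-adjacent : ∀ z → not (adj Γ x z) ≡ (part z == part x)
    non-adjacent z = trans (cong not (∨-comm (arc Γ x z) _)) (sym (same-part≡¬adj z x))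

  part-size-const : ∀ x y → count (λ z → part z == part x) ≡ count (λ z → part z == part y)
  part-size-const x y = +-cancelˡ-≡ (sumRel (λ T → valency Γ T x)) _ _ (begin
    sumRel (λ T → valency Γ T x) + count (λ z → part z == part x) ≡⟨ vertex-split x ⟨
    n                                                             ≡⟨ vertex-split y ⟩
    sumRel (λ T → valency Γ T y) + count (λ z → part z == part y) ≡⟨ cong (_+ count (λ z → part z == part y))
                                                                          (sumRel-cong λ T → valency-const T y x) ⟩
    sumRel (λ T → valency Γ T x) + count (λ z → part z == part y) ∎)

  m : ℕ
  m = count (λ z → part z == part (src edge))

  part-size : ∀ i → count (λ z → part z == i) ≡ m
  part-size i = subst (λ i → count (λ z → part z == i) ≡ m) (part-rep i) (part-size-const (rep i) (src edge))

  2≤m : 2 ≤ m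
  2≤m = subst (2 ≤_) (part-size _) (parts≥2 (part (src edge)))

  edge-neighbour : ∀ x → ∃[ v ] rel Γ edge x v ≡ true
  edge-neighbour x = count-witness (rel Γ edge x)
    (subst (1 ≤_) (valency-const edge (src edge) x) (𝟙≤count (rel Γ edge (src edge)) (src-tgt edge)))

  regular : Regular Γ
  regular = valency Γ edge (src edge) + valency Γ fwd (src edge) , λ x → out-degree x , in-degree x
    where
    out-degree : ∀ x → count (λ y → arc Γ x y) ≡ valency Γ edge (src edge) + valency Γ fwd (src edge)
    out-degree x = trans (count-+ (𝟙-out Γ true x))
                         (cong₂ _+_ (valency-const edge x _) (valency-const fwd x _))
    in-degree : ∀ x → count (λ y → arc Γ y x) ≡ valency Γ edge (src edge) + valency Γ fwd (src edge)
    in-degree x = trans (count-+ (𝟙-in Γ true x))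
                        (cong₂ _+_ (valency-const edge x _) (trans (valency-rev fwd x) (valency-const fwd x _)))

  module Twins (twins : ∀ x x′ → part x ≡ part x′ → ∀ w → arcs Γ w x ≡ arcs Γ w x′) where

    S : Digraph k
    S = record { arc = λ i j → arc Γ (rep i) (rep j) ; irrefl = λ i → irrefl Γ (rep i) }

    arc-repˡ : ∀ x y → arc Γ (rep (part x)) y ≡ arc Γ x y
    arc-repˡ x y = sym (cong proj₂ (twins x (rep (part x)) (sym (part-rep _)) y))

    arc-repʳ : ∀ x y → arc Γ x (rep (part y)) ≡ arc Γ x y
    arc-repʳ x y = sym (cong proj₁ (twins y (rep (part y)) (sym (part-rep _)) x))

    arc-part : ∀ x y → arc Γ x y ≡ arc S (part x) (part y)
    arc-part x y = sym (trans (arc-repˡ x (rep (part y))) (arc-repʳ x y))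

    semicomplete : Semicomplete S
    semicomplete i j i≢j = rep-adjacent (i≢j ∘ trans (sym (part-rep i)))

    ¬arc-rep⇒∂≡2 : ∀ {u v} → u ≢ v → arc Γ (rep u) (rep v) ≡ false → ∂ Γ (rep u) (rep v) ≡ just 2
    ¬arc-rep⇒∂≡2 {u} {v} u≢v ¬uv = one-way⇒∂≡2 (rep v) (rep u) (cong₂ (λ a b → a ∧ not b) vu ¬uv)
      where
      vu : arc Γ (rep v) (rep u) ≡ true
      vu = subst (λ b → b ∨ arc Γ (rep v) (rep u) ≡ true) ¬uv (semicomplete u v u≢v)

    ∂-rep : ∀ {u v} → u ≢ v → ∂ S u v ≡ ∂ Γ (rep u) (rep v)
    ∂-rep {u} {v} u≢v with arc Γ (rep u) (rep v) in uv
    ... | true  = trans (arc⇒∂≡1 S uv) (sym (arc⇒∂≡1 Γ uv))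
    ... | false with z , uz , zv ← ∂≡2⇒path Γ (¬arc-rep⇒∂≡2 u≢v uv) =
      trans (path⇒∂≡2 S (part z) u≢v uv (trans (arc-repʳ (rep u) z) uz) (trans (arc-repˡ z (rep v)) zv))
            (sym (¬arc-rep⇒∂≡2 u≢v uv))

    ∂̃-rep : ∀ u v → ∂̃ S u v ≡ ∂̃ Γ (rep u) (rep v)
    ∂̃-rep u v = by-cases (u ≟ᶠ v)
      where
      by-cases : Dec (u ≡ v) → ∂̃ S u v ≡ ∂̃ Γ (rep u) (rep v)
      by-cases (yes refl) = trans (∂̃-refl S u) (sym (∂̃-refl Γ (rep u)))
      by-cases (no  u≢v)  = cong₂ _,_ (∂-rep u≢v) (∂-rep (u≢v ∘ sym))

    one-way⇒∂≡2-S : ∀ u v → A₁ S u v ≡ true → ∂ S v u ≡ just 2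
    one-way⇒∂≡2-S u v r =
      trans (∂-rep (arc⇒≢ S (∧-conicalˡ _ _ r) ∘ sym)) (one-way⇒∂≡2 (rep u) (rep v) r)

    classes-S : ∀ {a} → In∂̃ S a → a ≡ O ⊎ ∃[ T ] a ≡ cls T
    classes-S (u , v , refl) = by-cases (u ≟ᶠ v)
      where
      by-cases : Dec (u ≡ v) → ∂̃ S u v ≡ O ⊎ ∃[ T ] ∂̃ S u v ≡ cls T
      by-cases (yes refl) = inj₁ (∂̃-refl S u)
      by-cases (no  u≢v) with T , r ← adj⇒rel S u v (semicomplete u v u≢v) =
        inj₂ (T , rel⇒∂̃≡cls S one-way⇒∂≡2-S T u v r)

    pRel-rep : ∀ T U u v → pRel Γ T U (rep u) (rep v) ≡ m * pRel S T U u v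
    pRel-rep T U u v = trans (count-cong λ z → sym (cong₂ _∧_ (rel-repʳ T u z) (rel-repˡ U z v)))
                             (count-fibres part part-size (λ w → rel S T u w ∧ rel S U w v))
      where
      rel-repʳ : ∀ T u z → rel S T u (part z) ≡ rel Γ T (rep u) z
      rel-repʳ T u z = rel-cong S Γ (arc-repʳ (rep u) z) (arc-repˡ z (rep u)) T
      rel-repˡ : ∀ U z v → rel S U (part z) v ≡ rel Γ U z (rep v)
      rel-repˡ U z v = rel-cong S Γ (arc-repˡ z (rep v)) (arc-repʳ (rep v) z) U

    instance
      m-nonZero : NonZero m
      m-nonZero = >-nonZero (≤-trans (s≤s z≤n) 2≤m)

    pRel-S-∂̃ : ∀ T U {u v u′ v′} → ∂̃ S u v ≡ ∂̃ S u′ v′ → pRel S T U u v ≡ pRel S T U u′ v′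
    pRel-S-∂̃ T U {u} {v} {u′} {v′} eq = *-cancelˡ-≡ _ _ m (begin
      m * pRel S T U u v            ≡⟨ pRel-rep T U u v ⟨
      pRel Γ T U (rep u) (rep v)    ≡⟨ pRel-∂̃ T U (trans (sym (∂̃-rep u v)) (trans eq (∂̃-rep u′ v′))) ⟩
      pRel Γ T U (rep u′) (rep v′)  ≡⟨ pRel-rep T U u′ v′ ⟩
      m * pRel S T U u′ v′          ∎)

    p-S-∂̃ : ∀ {a b} → In∂̃ S a → In∂̃ S b →
            ∀ {u v u′ v′} → ∂̃ S u v ≡ ∂̃ S u′ v′ → p S a b u v ≡ p S a b u′ v′
    p-S-∂̃ {a} {b} Ia Ib {u} {v} {u′} {v′} eq with classes-S Ia | classes-S Ib
    ... | inj₁ refl | _ = trans (p-O-left S b u v)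
                                (trans (cong (λ c → 𝟙 (does (c ≟ᶜ b))) eq) (sym (p-O-left S b u′ v′)))
    ... | inj₂ _ | inj₁ refl = trans (p-O-right S a u v)
                                     (trans (cong (λ c → 𝟙 (does (c ≟ᶜ a))) eq) (sym (p-O-right S a u′ v′)))
    ... | inj₂ (T , refl) | inj₂ (U , refl) = begin
      p S (cls T) (cls U) u v    ≡⟨ p-cls S one-way⇒∂≡2-S T U u v ⟩
      pRel S T U u v             ≡⟨ pRel-S-∂̃ T U eq ⟩
      pRel S T U u′ v′           ≡⟨ p-cls S one-way⇒∂≡2-S T U u′ v′ ⟨
      p S (cls T) (cls U) u′ v′  ∎

    strongly-connected-S : StronglyConnected S
    strongly-connected-S u v = by-cases (u ≟ᶠ v)
      where
      by-cases : Dec (u ≡ v) → ∃[ d ] ∂ S u v ≡ just d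
      by-cases (yes refl) = 0 , ∂-refl S u
      by-cases (no  u≢v) with d , eq ← strongly-connected (rep u) (rep v) = d , trans (∂-rep u≢v) eq

    not-symmetric-S : NotSymmetric S
    not-symmetric-S = part (src fwd) , part (tgt fwd) ,
      trans (sym (arc-part _ _)) (cong proj₁ one-way) , trans (sym (arc-part _ _)) (cong proj₂ one-way)
      where
      one-way : arcs Γ (src fwd) (tgt fwd) ≡ (true , false)
      one-way = rel⇒arcs Γ fwd _ _ (src-tgt fwd)

    girth-S : Girth S 2
    girth-S = girth-two S (trans (sym (arc-part _ _)) (cong proj₁ two-way))
                          (trans (sym (arc-part _ _)) (cong proj₂ two-way))
      where
      two-way : arcs Γ (src edge) (tgt edge) ≡ (true , true)
      two-way = rel⇒arcs Γ edge _ _ (src-tgt edge)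

    coclique-extension : ∃[ s ] Σ (Digraph s) λ S → ∃[ l ] (2 ≤ l × Semicomplete S × WeaklyDistanceRegular S
                           × (Girth S 2 ⊎ Girth S 3) × Γ ≅ cocliqueExt S l)
    coclique-extension = k , S , m , 2≤m , semicomplete ,
      (strongly-connected-S , not-symmetric-S ,
       λ _ _ _ Ia Ib _ u v u′ v′ e e′ → p-S-∂̃ Ia Ib (trans e (sym e′))) ,
      inj₁ girth-S , ≅-cocliqueExt Γ S part part-size arc-part

  module NonTwins {x₀ x₀′ w : Fin n} (same : part x₀ ≡ part x₀′) (differ : arcs Γ w x₀ ≢ arcs Γ w x₀′) where

    row : Rel → Rel → ℕ
    row T V = deg V (src T) (part (tgt T))

    deg≡row : ∀ T V {x y} → rel Γ T x y ≡ true → deg V x (part y) ≡ row T V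
    deg≡row T V r = deg-∂̃ V (same-class T r (src-tgt T))

    row-rev : ∀ T V → row T V ≡ row (rev T) (rev V)
    row-rev T V = trans (deg-rev V (src T) (tgt T))
                        (deg≡row (rev T) (rev V) (trans (rel-rev Γ T (tgt T) (src T)) (src-tgt T)))

    w~x₀ : adj Γ w x₀ ≡ true
    w~x₀ = ¬-not λ w≁x₀ → differ (trans (¬adj⇒arcs Γ w x₀ w≁x₀)
                                        (sym (¬adj⇒arcs Γ w x₀′ (trans (sym (adj-part same)) w≁x₀))))

    T₀ U₀ : Rel
    T₀ = proj₁ (adj⇒rel Γ w x₀ w~x₀)
    U₀ = proj₁ (adj⇒rel Γ w x₀′ (trans (sym (adj-part same)) w~x₀))

    T₀≢U₀ : T₀ ≢ U₀
    T₀≢U₀ T₀≡U₀ = differ (begin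
      arcs Γ w x₀    ≡⟨ rel⇒arcs Γ T₀ w x₀ (proj₂ (adj⇒rel Γ w x₀ w~x₀)) ⟩
      code T₀        ≡⟨ cong code T₀≡U₀ ⟩
      code U₀        ≡⟨ rel⇒arcs Γ U₀ w x₀′ (proj₂ (adj⇒rel Γ w x₀′ _)) ⟨
      arcs Γ w x₀′   ∎)

    equal-rows : ∀ V → row T₀ V ≡ row U₀ V
    equal-rows V = begin
      row T₀ V             ≡⟨ deg≡row T₀ V (proj₂ (adj⇒rel Γ w x₀ w~x₀)) ⟨
      deg V w (part x₀)    ≡⟨ cong (deg V w) same ⟩
      deg V w (part x₀′)   ≡⟨ deg≡row U₀ V (proj₂ (adj⇒rel Γ w x₀′ _)) ⟩
      row U₀ V             ∎

    balanced : ∀ x y → adj Γ x y ≡ true → deg fwd x (part y) ≡ deg bwd x (part y)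
    balanced x y x~y with T , r ← adj⇒rel Γ x y x~y =
      trans (deg≡row T fwd r) (trans (equal-rows⇒fwd≡bwd row row-rev T₀≢U₀ equal-rows T) (sym (deg≡row T bwd r)))

    balanced-part : ∀ x j → part x ≢ j → deg fwd x j ≡ deg bwd x j
    balanced-part x j x∉j =
      subst (λ j → deg fwd x j ≡ deg bwd x j) (part-rep j) (balanced x (rep j) (rep-adjacent x∉j))

    -- Inside the part of an edge-neighbour v of x, the out-neighbours of x and the in-neighbours of x′
    -- number e + c each, while the part has only e + 2c vertices; so they share at least e ≥ 1.
    common-neighbour : ∀ {x x′ v} → part x ≡ part x′ → rel Γ edge x v ≡ true →
                       ∃[ z ] arc Γ x z ≡ true × arc Γ z x′ ≡ true
    common-neighbour {x} {x′} {v} same-x xv =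
      both-arcs (count-witness (λ z → Out z ∧ In z) (≤-trans 1≤e e≤overlap))
      where
      j : Fin k
      j = part v
      e c : ℕ
      e = deg edge x j
      c = deg fwd x j
      Out In : Fin n → Bool
      Out z = (part z == j) ∧ arc Γ x z
      In  z = (part z == j) ∧ arc Γ z x′
      x~v : adj Γ x v ≡ true
      x~v = cong (_∨ arc Γ v x) (∧-conicalˡ _ _ xv)
      |Out| : count Out ≡ e + c
      |Out| = count-+ (λ z → 𝟙-out Γ (part z == j) x z)
      |In| : count In ≡ e + c
      |In| = trans (count-+ (λ z → 𝟙-in Γ (part z == j) x′ z))
                   (cong₂ _+_ (deg-part-invariant edge j (sym same-x))
                              (trans (deg-part-invariant bwd j (sym same-x)) (sym (balanced x v x~v))))
      |Out∨In| : count (λ z → Out z ∨ In z) ≤ e + c + c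
      |Out∨In| = ≤-trans (count-mono (λ z h → ∧-conicalˡ _ _ (trans (∧-distribˡ-∨ (part z == j) _ _) h)))
                         (≤-reflexive (trans (part-size-split x j (proj₁ (multipartite x v) x~v))
                                             (cong (e + c +_) (sym (balanced x v x~v)))))
      1≤e : 1 ≤ e
      1≤e = 𝟙≤count _ {v} (trans (cong (_∧ rel Γ edge x v) (==-refl j)) xv)
      e≤overlap : e ≤ count (λ z → Out z ∧ In z)
      e≤overlap = count-∧-lower-bound Out In |Out| |In| |Out∨In|
      both-arcs : ∃[ z ] Out z ∧ In z ≡ true → ∃[ z ] arc Γ x z ≡ true × arc Γ z x′ ≡ true
      both-arcs (z , both) = z , ∧-conicalʳ (part z == j) _ (∧-conicalˡ (Out z) (In z) both)
                               , ∧-conicalʳ (part z == j) _ (∧-conicalʳ (Out z) (In z) both)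

    ∂̃-same-part : ∀ {x x′} → x ≢ x′ → part x ≡ part x′ → ∂̃ Γ x x′ ≡ (just 2 , just 2)
    ∂̃-same-part x≢x′ same-x = cong₂ _,_ (∂≡2 x≢x′ same-x) (∂≡2 (x≢x′ ∘ sym) (sym same-x))
      where
      ∂≡2 : ∀ {x x′} → x ≢ x′ → part x ≡ part x′ → ∂ Γ x x′ ≡ just 2
      ∂≡2 {x} {x′} x≢x′ same-x = via (common-neighbour same-x (proj₂ (edge-neighbour x)))
        where
        via : ∃[ z ] arc Γ x z ≡ true × arc Γ z x′ ≡ true → ∂ Γ x x′ ≡ just 2
        via (z , xz , zx′) = path⇒∂≡2 Γ z x≢x′ (same-part⇒¬arc same-x) xz zx′

    x₀≢x₀′ : x₀ ≢ x₀′
    x₀≢x₀′ refl = differ refl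

    rhs-of-invariant : (g : Fin n → Fin n → ℕ) →
      (∀ {x y x′ y′} → ∂̃ Γ x y ≡ ∂̃ Γ x′ y′ → g x y ≡ g x′ y′) →
      (δ : Bool) (t : ℤ) → (∀ x → ℤ.+ g x x ≡ (if δ then t else ℤ.+ 0)) → ∀ x y →
      ℤ.+ g x y ≡ rhs Γ δ t (ℤ.+ g (src fwd) (tgt fwd)) (ℤ.+ g (tgt fwd) (src fwd))
                            (ℤ.+ g (src edge) (tgt edge)) (ℤ.+ g x₀ x₀′) x y
    rhs-of-invariant g g-∂̃ δ t diagonal x y with x ≟ᶠ y
    ... | yes refl = diagonal x
    ... | no  x≢y with A₁ Γ x y in xy
    ... | true = cong ℤ.+_ (g-∂̃ (same-class fwd xy (src-tgt fwd)))
    ... | false with A₁ Γ y x in yx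
    ... | true = cong ℤ.+_ (g-∂̃ (same-class bwd yx (src-tgt fwd)))
    ... | false with A₀ Γ x y in xy₀
    ... | true = cong ℤ.+_ (g-∂̃ (same-class edge xy₀ (src-tgt edge)))
    ... | false =
      cong ℤ.+_ (g-∂̃ (trans (∂̃-same-part x≢y (¬adj⇒same-part x≁y)) (sym (∂̃-same-part x₀≢x₀′ same))))
      where
      x≁y : adj Γ x y ≡ false
      x≁y = ¬-not (uncurry excluded ∘ adj⇒rel Γ x y)
        where
        excluded : ∀ T → rel Γ T x y ≢ true
        excluded edge r = contradiction (trans (sym xy₀) r) λ ()
        excluded fwd  r = contradiction (trans (sym xy) r) λ ()
        excluded bwd  r = contradiction (trans (sym yx) r) λ ()

    -- entry (x , y) of A_i A_j for i + j = s; only s ≤ 2 occurs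
    product-entry : ℕ → Fin n → Fin n → ℕ
    product-entry 0 = pRel Γ edge edge
    product-entry 1 = pRel Γ edge fwd
    product-entry _ = pRel Γ fwd fwd

    t : ℤ
    t = ℤ.+ pRel Γ edge edge x₀ x₀

    α β γ η : ℕ → ℤ
    α s = ℤ.+ product-entry s (src fwd) (tgt fwd)
    β s = ℤ.+ product-entry s (tgt fwd) (src fwd)
    γ s = ℤ.+ product-entry s (src edge) (tgt edge)
    η s = ℤ.+ product-entry s x₀ x₀′

    doubly-regular : DRCoeffs Γ t α β γ η
    doubly-regular zero zero = rhs-of-invariant (product-entry 0) (pRel-∂̃ edge edge) true t
      (λ x → cong ℤ.+_ (pRel-∂̃ edge edge (trans (∂̃-refl Γ x) (sym (∂̃-refl Γ x₀)))))
    doubly-regular zero (suc zero) = rhs-of-invariant (product-entry 1) (pRel-∂̃ edge fwd) false t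
      (λ x → cong ℤ.+_ (pRel-diagonal Γ edge fwd (λ ()) x))
    doubly-regular (suc zero) zero x y =
      trans (cong ℤ.+_ (pRel-comm fwd edge x y)) (doubly-regular zero (suc zero) x y)
    doubly-regular (suc zero) (suc zero) = rhs-of-invariant (product-entry 2) (pRel-∂̃ fwd fwd) false t
      (λ x → cong ℤ.+_ (pRel-diagonal Γ fwd fwd (λ ()) x))

    fwd-walks-sym : ∀ {x y} → adj Γ x y ≡ true →
                    sumRel (λ U → pRel Γ U fwd x y) ≡ sumRel (λ U → pRel Γ U fwd y x)
    fwd-walks-sym {x} {y} x~y = +-cancelˡ-≡ (deg bwd x (part y)) _ _ (begin
      deg bwd x (part y) + sumRel (λ U → pRel Γ U fwd x y)
        ≡⟨ cong (_+ sumRel (λ U → pRel Γ U fwd x y)) (trans (deg-rev bwd y x) (balanced x y x~y)) ⟨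
      deg bwd y (part x) + sumRel (λ U → pRel Γ U fwd x y)  ≡⟨ in-flow x y ⟨
      valency Γ bwd y                                       ≡⟨ valency-const bwd y x ⟩
      valency Γ bwd x                                       ≡⟨ in-flow y x ⟩
      deg bwd x (part y) + sumRel (λ U → pRel Γ U fwd y x)  ∎)

    β-α : β 1 ℤ.+ β 2 ℤ.- α 1 ℤ.- α 2 ≡ ℤ.+ 0
    β-α = trans (cong (λ s → ℤ.+ s ℤ.- α 1 ℤ.- α 2) walks) (cancel (α 1) (α 2))
      where
      x y : Fin n
      x = src fwd
      y = tgt fwd
      walks : pRel Γ edge fwd y x + pRel Γ fwd fwd y x ≡ pRel Γ edge fwd x y + pRel Γ fwd fwd x y
      walks = +-cancelʳ-≡ (pRel Γ bwd fwd y x) _ _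
        (trans (sym (fwd-walks-sym (cong (_∨ arc Γ y x) (∧-conicalˡ _ _ (src-tgt fwd)))))
               (cong (pRel Γ edge fwd x y + pRel Γ fwd fwd x y +_) (sym (pRel-rev Γ fwd fwd x y))))
      cancel : ∀ a b → a ℤ.+ b ℤ.- a ℤ.- b ≡ ℤ.+ 0
      cancel = ℤ-Solver.solve-∀

    e c : Fin k → Fin k → ℕ
    e i j = deg edge (rep i) j
    c i j = deg fwd (rep i) j

    team-degrees : ∀ i j → i ≢ j → ∀ x → part x ≡ i →
                   count (λ y → (part y == j) ∧ A₀ Γ x y) ≡ e i j
                   × count (λ y → (part y == j) ∧ A₁ Γ x y) ≡ c i j
    team-degrees i j _ x x∈i = deg-part-invariant edge j x∼rep , deg-part-invariant fwd j x∼rep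
      where
      x∼rep : part x ≡ part (rep i)
      x∼rep = trans x∈i (sym (part-rep i))

    team-balance : ∀ i j → i ≢ j → c i j ≡ c j i × 2 * c i j + e i j ≡ m
    team-balance i j i≢j = c-sym , size
      where
      i∉j : part (rep i) ≢ j
      i∉j = i≢j ∘ trans (sym (part-rep i))
      c-sym : c i j ≡ c j i
      c-sym = begin
        deg fwd (rep i) j               ≡⟨ balanced-part (rep i) j i∉j ⟩
        deg bwd (rep i) j               ≡⟨ cong (deg bwd (rep i)) (part-rep j) ⟨
        deg bwd (rep i) (part (rep j))  ≡⟨ deg-rev bwd (rep i) (rep j) ⟩
        deg fwd (rep j) (part (rep i))  ≡⟨ cong (deg fwd (rep j)) (part-rep i) ⟩
        deg fwd (rep j) i               ∎
      size : 2 * c i j + e i j ≡ m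
      size = begin
        2 * c i j + e i j                         ≡⟨ rearrange (e i j) (c i j) ⟩
        e i j + c i j + c i j                     ≡⟨ cong (e i j + c i j +_) (balanced-part (rep i) j i∉j) ⟩
        sumRel (λ T → deg T (rep i) j)            ≡⟨ part-size-split (rep i) j i∉j ⟨
        count (λ z → part z == j)                 ≡⟨ part-size j ⟩
        m                                         ∎
        where
        rearrange : ∀ e c → 2 * c + e ≡ e + c + c
        rearrange = ℕ-Solver.solve-∀

    team : 2 ≤ k → TypeIITeam Γ k m
    team 2≤k = 2≤k , 2≤m , part , (multipartite , part-size) , regular ,
               t , α , β , γ , η , doubly-regular , β-α , e , c , team-degrees , team-balance

_≟ᵃ_ : DecidableEquality (Bool × Bool)
_≟ᵃ_ = ×-≡-dec _≟ᵇ_ _≟ᵇ_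

twins-or-witness : ∀ {n k} (G : Digraph n) (part : Fin n → Fin k) →
  (∀ x x′ → part x ≡ part x′ → ∀ w → arcs G w x ≡ arcs G w x′)
  ⊎ (∃[ x ] ∃[ x′ ] ∃[ w ] part x ≡ part x′ × arcs G w x ≢ arcs G w x′)
twins-or-witness G part
  with any? (λ x → any? λ x′ → any? λ w → (part x ≟ᶠ part x′) ×-dec ¬? (arcs G w x ≟ᵃ arcs G w x′))
... | yes witness    = inj₂ witness
... | no  no-witness = inj₁ λ x x′ same w →
  decidable-stable (arcs G w x ≟ᵃ arcs G w x′) λ differ → no-witness (x , x′ , w , same , differ)

proposition8p6 : ∀ {n} (Γ : Digraph n) →
    SemicompleteMultipartite Γ → WeaklyDistanceRegular Γ → Commutative Γ →
    (∀ d → In∂̃ Γ (just 1 , just d) ⇔ (suc d ≡ 2 ⊎ suc d ≡ 3)) →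
    (∃[ s ] Σ (Digraph s) λ S → ∃[ l ] (2 ≤ l × Semicomplete S × WeaklyDistanceRegular S
        × (Girth S 2 ⊎ Girth S 3) × Γ ≅ cocliqueExt S l))
    ⊎ (∃[ k ] ∃[ m ] Σ (Digraph n) λ Δ → TypeIITeam Δ k m × Γ ≅ Δ)
proposition8p6 Γ (k , part , 2≤k , multipartite , parts≥2) wdr commutative classes
  with twins-or-witness Γ part
... | inj₁ twins = inj₁ (Twins.coclique-extension twins)
  where open WDRMultipartite Γ part multipartite parts≥2 wdr commutative classes
... | inj₂ (_ , _ , _ , same , differ) = inj₂ (k , m , Γ , NonTwins.team same differ 2≤k , ↔-id _ , λ _ _ → refl)
  where open WDRMultipartite Γ part multipartite parts≥2 wdr commutative classes
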